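{- For all $m,n\in\mathbb{N}$, \[ S_{m,n}(q)=\sum_{r=0}^{\lfloor m/2\rfloor}(-1)^r\left[\binom{m-1}{r}-\binom{m-1}{r-2}\right]\frac{(1-q^{(\frac{m+1}{2}-r)n})(1+(-1)^mq^{(\frac{m+1}{2}-r)(n+1)})q^{rn}}{(1-q^2)(1-q)^{m-1}(1-q^{\frac{m+1}{2}-r})}. \]
   Context: Here $\mathbb{N}=\{1,2,3,\dots\}$, $q$ is an indeterminate and identities are identities of rational functions in $q^{1/2}$. For positive integers $m,n$, \[ S_{m,n}(q)=\sum_{k=1}^{n}\frac{1-q^{2k}}{1-q^2}\left(\frac{1-q^k}{1-q}\right)^{m-1}q^{\frac{m+1}{2}(n-k)}. \] Binomial coefficients $\binom{a}{b}$ are taken to be $0$ when $b<0$. -}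

module Defs where

open import Data.Nat as ℕ using (ℕ; zero; suc; _∸_; _<ᵇ_)
open import Data.Nat.Combinatorics using (_C_)
open import Data.Bool using (if_then_else_)
open import Data.Integer as ℤ using (ℤ; +_)
open import Data.Rational using (ℚ; 0ℚ; 1ℚ; _+_; _*_; _-_; -_; _÷_; _/_; ≢-nonZero)
open import Data.Rational.Properties using (_≟_)
open import Relation.Nullary using (yes; no)

infixr 8 _^_
_^_ : ℚ → ℕ → ℚ
x ^ zero  = 1ℚ
x ^ suc n = x * (x ^ n)

-- total division on ℚ (x ⊘ 0 = 0); only ever used with nonzero divisors
infixl 7 _⊘_
_⊘_ : ℚ → ℚ → ℚ
x ⊘ y with y ≟ 0ℚ
... | yes _  = 0ℚ
... | no y≢0 = _÷_ x y {{≢-nonZero y≢0}}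

ι : ℤ → ℚ
ι z = z / 1

-- Σ_{i=a}^{b} f i  (empty, i.e. 0, when b < a)
Σ[_⋯_] : ℕ → ℕ → (ℕ → ℚ) → ℚ
Σ[ a ⋯ b ] f = go (suc b ∸ a)
  where
  go : ℕ → ℚ
  go zero    = 0ℚ
  go (suc k) = f (a ℕ.+ k) + go k

-- binomial coefficient binom a b for an integer b, with binom a b = 0 for b < 0;
-- here b = r - 2 is encoded by r
binomMinus2 : ℕ → ℕ → ℕ
binomMinus2 a r = if r <ᵇ 2 then 0 else a C (r ∸ 2)

signℤ : ℕ → ℤ
signℤ zero    = + 1
signℤ (suc r) = ℤ.- signℤ r

-- Throughout, t plays the role of q^{1/2}, so q = t^2 and
-- q^{e/2} = t^e for natural e.

S : ℕ → ℕ → ℚ → ℚ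
S m n t = Σ[ 1 ⋯ n ] λ k →
  ((1ℚ - q ^ (2 ℕ.* k)) ⊘ (1ℚ - q ^ 2))
  * (((1ℚ - q ^ k) ⊘ (1ℚ - q)) ^ (m ∸ 1))
  * (t ^ ((m ℕ.+ 1) ℕ.* (n ∸ k)))
  where q = t ^ 2

-- Right-hand side: with e_r = m+1-2r, so that q^{(m+1)/2 - r} = t^{e_r},
-- Σ_{r=0}^{⌊m/2⌋} (-1)^r [C(m-1,r) - C(m-1,r-2)]
--   (1 - q^{((m+1)/2-r) n}) (1 + (-1)^m q^{((m+1)/2-r)(n+1)}) q^{rn}
--   / ((1-q^2)(1-q)^{m-1}(1-q^{(m+1)/2-r}))
RHS : ℕ → ℕ → ℚ → ℚ
RHS m n t = Σ[ 0 ⋯ m ℕ./ 2 ] λ r →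
  let e = m ℕ.+ 1 ∸ 2 ℕ.* r in
  (ι (signℤ r ℤ.* (+ ((m ∸ 1) C r) ℤ.- + binomMinus2 (m ∸ 1) r))
   * (1ℚ - t ^ (e ℕ.* n))
   * (1ℚ + ι (signℤ m) * t ^ (e ℕ.* (n ℕ.+ 1)))
   * (q ^ (r ℕ.* n)))
  ⊘ ((1ℚ - q ^ 2) * ((1ℚ - q) ^ (m ∸ 1)) * (1ℚ - t ^ e))
  where q = t ^ 2

{-# OPTIONS --safe #-}
module Submission where

-- Put q = t², m = M + 1 and ρ = t^(m+1) = q^((m+1)/2). Splitting off the summand k = n + 1 gives
-- S_{m,n+1} = w(n+1) + ρ S_{m,n} with w(k) = (1-q^{2k})(1-q^k)^M / ((1-q²)(1-q)^M), and S_{m,0} = 0.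
-- The right-hand side satisfies the same recurrence. With c_r = (-1)^r [C(M,r) - C(M,r-2)] and
-- a = q^((m+1)/2-r), so that ρ = a q^r, the r-th summand R_r(n) obeys
--   R_r(n+1) = c_r (x^r + (-1)^m x^(m+1-r)) / ((1-q²)(1-q)^M) + ρ R_r(n),   x = q^(n+1),
-- and the first terms add up to w(n+1) because
--   Σ_{r ≤ ⌊m/2⌋} c_r (x^r + (-1)^m x^(m+1-r)) = (1-x²)(1-x)^M.
-- This holds since c_r is the coefficient of x^r in (1-x²)(1-x)^M, a polynomial of degree m+1 whose
-- coefficients satisfy c_(m+1-r) = (-1)^m c_r, the middle one vanishing when m is odd; it is proved by
-- induction on M from Pascal's rule c_(M+1)(r+1) = c_M(r+1) - c_M(r).

open import Defs
open import Data.Nat using (ℕ; suc; _≤_)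
open import Data.Rational using (ℚ; 1ℚ)
open import Relation.Binary.PropositionalEquality using (_≡_; _≢_)

open import Algebra.Bundles using (CommutativeMonoid)
import Algebra.Properties.CommutativeSemigroup as CommutativeSemigroupProperties
import Algebra.Properties.Group as GroupProperties
open import Data.Empty using (⊥-elim)
open import Data.Integer as ℤ using (-[1+_]; +[1+_])
import Data.Integer.Properties as ℤₚ
import Data.Integer.Tactic.RingSolver as ℤ-Solver
open import Data.Nat as ℕ using (zero; _<_; _∸_; ⌊_/2⌋; ⌈_/2⌉)
open import Data.Nat.Combinatorics using (_C_; nCk+nC[k+1]≡[n+1]C[k+1]; nCk≡nC[n∸k])
import Data.Nat.Coprimality as Coprimality
open import Data.Nat.DivMod using (m/n≡1+[m∸n]/n)
import Data.Nat.Properties as ℕₚ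
open import Data.Product using (_,_; ∃-syntax)
open import Data.Rational using (mkℚ; 0ℚ; _+_; _*_; _-_; -_; 1/_; _/_; NonZero; ≢-nonZero)
import Data.Rational.Properties as ℚₚ
open import Data.Rational.Solver using (module +-*-Solver)
open import Data.Sum using (_⊎_; inj₁; inj₂)
open import Relation.Binary.PropositionalEquality
  using (refl; sym; trans; cong; cong₂; subst; subst₂; module ≡-Reasoning)
open import Relation.Nullary using (yes; no)

open +-*-Solver using (solve; _:=_; _:+_; _:*_; _:-_; :-_; con)
open GroupProperties ℚₚ.+-0-group using (⁻¹-involutive; x∙y⁻¹≈ε⇒x≈y)
module ℚ+ = CommutativeSemigroupProperties
  (CommutativeMonoid.commutativeSemigroup ℚₚ.+-0-commutativeMonoid)
module ℚ* = CommutativeSemigroupProperties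
  (CommutativeMonoid.commutativeSemigroup ℚₚ.*-1-commutativeMonoid)
open ≡-Reasoning

ι≡mkℚ : ∀ z → ι z ≡ mkℚ z 0 (Coprimality.sym (Coprimality.1-coprimeTo ℤ.∣ z ∣))
ι≡mkℚ (ℤ.+ n)  = ℚₚ.normalize-coprime (Coprimality.sym (Coprimality.1-coprimeTo n))
ι≡mkℚ -[1+ n ] = cong -_ (ℚₚ.normalize-coprime (Coprimality.sym (Coprimality.1-coprimeTo (suc n))))

ι-homo-+ : ∀ a b → ι (a ℤ.+ b) ≡ ι a + ι b
ι-homo-+ a b rewrite ι≡mkℚ a | ι≡mkℚ b =
  cong (_/ 1) (sym (cong₂ ℤ._+_ (ℤₚ.*-identityʳ a) (ℤₚ.*-identityʳ b)))

ι-homo‿- : ∀ a → ι (ℤ.- a) ≡ - ι a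
ι-homo‿- (ℤ.+ zero) = refl
ι-homo‿- +[1+ n ]   = refl
ι-homo‿- -[1+ n ]   = sym (⁻¹-involutive (ι (ℤ.+ suc n)))

ι-homo-− : ∀ a b → ι (a ℤ.- b) ≡ ι a - ι b
ι-homo-− a b = trans (ι-homo-+ a (ℤ.- b)) (cong (ι a +_) (ι-homo‿- b))

1-x≢0 : ∀ {x} → x ≢ 1ℚ → 1ℚ - x ≢ 0ℚ
1-x≢0 {x} x≢1 1-x≡0 = x≢1 (sym (x∙y⁻¹≈ε⇒x≈y 1ℚ x 1-x≡0))

*-≢0 : ∀ {x y} → x ≢ 0ℚ → y ≢ 0ℚ → x * y ≢ 0ℚ
*-≢0 {x} {y} x≢0 y≢0 xy≡0 = y≢0 (begin
  y               ≡⟨ ℚₚ.*-identityˡ y ⟨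
  1ℚ * y          ≡⟨ cong (_* y) (ℚₚ.*-inverseˡ x) ⟨
  1/ x * x * y    ≡⟨ ℚₚ.*-assoc (1/ x) x y ⟩
  1/ x * (x * y)  ≡⟨ cong (1/ x *_) xy≡0 ⟩
  1/ x * 0ℚ       ≡⟨ ℚₚ.*-zeroʳ (1/ x) ⟩
  0ℚ              ∎)
  where instance x≢0′ : NonZero x
                 x≢0′ = ≢-nonZero x≢0

^-≢0 : ∀ {x} n → x ≢ 0ℚ → x ^ n ≢ 0ℚ
^-≢0 zero    _   = ℚₚ.1≢0
^-≢0 (suc n) x≢0 = *-≢0 x≢0 (^-≢0 n x≢0)

^-distribˡ-+-* : ∀ x m n → x ^ (m ℕ.+ n) ≡ x ^ m * x ^ n
^-distribˡ-+-* x zero    n = sym (ℚₚ.*-identityˡ (x ^ n))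
^-distribˡ-+-* x (suc m) n =
  trans (cong (x *_) (^-distribˡ-+-* x m n)) (sym (ℚₚ.*-assoc x (x ^ m) (x ^ n)))

^-*-assoc : ∀ x m n → (x ^ m) ^ n ≡ x ^ (m ℕ.* n)
^-*-assoc x m zero    = cong (x ^_) (sym (ℕₚ.*-zeroʳ m))
^-*-assoc x m (suc n) = begin
  x ^ m * (x ^ m) ^ n    ≡⟨ cong (x ^ m *_) (^-*-assoc x m n) ⟩
  x ^ m * x ^ (m ℕ.* n)  ≡⟨ ^-distribˡ-+-* x m (m ℕ.* n) ⟨
  x ^ (m ℕ.+ m ℕ.* n)    ≡⟨ cong (x ^_) (ℕₚ.*-suc m n) ⟨
  x ^ (m ℕ.* suc n)      ∎

^-comm : ∀ x m n → (x ^ m) ^ n ≡ (x ^ n) ^ m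
^-comm x m n = begin
  (x ^ m) ^ n    ≡⟨ ^-*-assoc x m n ⟩
  x ^ (m ℕ.* n)  ≡⟨ cong (x ^_) (ℕₚ.*-comm m n) ⟩
  x ^ (n ℕ.* m)  ≡⟨ ^-*-assoc x n m ⟨
  (x ^ n) ^ m    ∎

⊘≡*1/ : ∀ x {y} (y≢0 : y ≢ 0ℚ) → x ⊘ y ≡ x * (1/ y) {{≢-nonZero y≢0}}
⊘≡*1/ x {y} y≢0 with y ℚₚ.≟ 0ℚ
... | yes y≡0 = ⊥-elim (y≢0 y≡0)
... | no _    = refl

x⊘y*y≡x : ∀ x {y} → y ≢ 0ℚ → x ⊘ y * y ≡ x
x⊘y*y≡x x {y} y≢0 = begin
  x ⊘ y * y       ≡⟨ cong (_* y) (⊘≡*1/ x y≢0) ⟩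
  x * 1/ y * y    ≡⟨ ℚₚ.*-assoc x (1/ y) y ⟩
  x * (1/ y * y)  ≡⟨ cong (x *_) (ℚₚ.*-inverseˡ y) ⟩
  x * 1ℚ          ≡⟨ ℚₚ.*-identityʳ x ⟩
  x               ∎
  where instance y≢0′ : NonZero y
                 y≢0′ = ≢-nonZero y≢0

⊘-unique : ∀ {x y z} → y ≢ 0ℚ → z * y ≡ x → x ⊘ y ≡ z
⊘-unique {y = y} {z} y≢0 refl = begin
  z * y ⊘ y       ≡⟨ ⊘≡*1/ (z * y) y≢0 ⟩
  z * y * 1/ y    ≡⟨ ℚₚ.*-assoc z y (1/ y) ⟩
  z * (y * 1/ y)  ≡⟨ cong (z *_) (ℚₚ.*-inverseʳ y) ⟩
  z * 1ℚ          ≡⟨ ℚₚ.*-identityʳ z ⟩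
  z               ∎
  where instance y≢0′ : NonZero y
                 y≢0′ = ≢-nonZero y≢0

0⊘y≡0 : ∀ y → 0ℚ ⊘ y ≡ 0ℚ
0⊘y≡0 y with y ℚₚ.≟ 0ℚ
... | yes _  = refl
... | no y≢0 = ℚₚ.*-zeroˡ ((1/ y) {{≢-nonZero y≢0}})

⊘-*-⊘ : ∀ a {b} c {d} → b ≢ 0ℚ → d ≢ 0ℚ → (a ⊘ b) * (c ⊘ d) ≡ (a * c) ⊘ (b * d)
⊘-*-⊘ a {b} c {d} b≢0 d≢0 = sym (⊘-unique (*-≢0 b≢0 d≢0) (begin
  (a ⊘ b) * (c ⊘ d) * (b * d)  ≡⟨ ℚ*.interchange (a ⊘ b) (c ⊘ d) b d ⟩
  (a ⊘ b * b) * (c ⊘ d * d)    ≡⟨ cong₂ _*_ (x⊘y*y≡x a b≢0) (x⊘y*y≡x c d≢0) ⟩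
  a * c                        ∎))

⊘-^ : ∀ x {y} n → y ≢ 0ℚ → (x ⊘ y) ^ n ≡ x ^ n ⊘ y ^ n
⊘-^ x     zero    y≢0 = refl
⊘-^ x {y} (suc n) y≢0 =
  trans (cong (x ⊘ y *_) (⊘-^ x n y≢0)) (⊘-*-⊘ x (x ^ n) y≢0 (^-≢0 n y≢0))

⊘-split : ∀ p c n {y z} → y ≢ 0ℚ → z ≢ 0ℚ →
          (p * z + c * n) ⊘ (y * z) ≡ p ⊘ y + c * (n ⊘ (y * z))
⊘-split p c n {y} {z} y≢0 z≢0 = ⊘-unique yz≢0 (begin
  (p ⊘ y + c * (n ⊘ (y * z))) * (y * z)
    ≡⟨ expand (p ⊘ y) c (n ⊘ (y * z)) y z ⟩
  p ⊘ y * y * z + c * (n ⊘ (y * z) * (y * z))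
    ≡⟨ cong₂ (λ u v → u * z + c * v) (x⊘y*y≡x p y≢0) (x⊘y*y≡x n yz≢0) ⟩
  p * z + c * n
    ∎)
  where
  yz≢0 = *-≢0 y≢0 z≢0
  expand : ∀ a c b y z → (a + c * b) * (y * z) ≡ a * y * z + c * (b * (y * z))
  expand = solve 5 (λ a c b y z → (a :+ c :* b) :* (y :* z) := a :* y :* z :+ c :* (b :* (y :* z))) refl

∑< : ℕ → (ℕ → ℚ) → ℚ
∑< zero    f = 0ℚ
∑< (suc n) f = f n + ∑< n f

Σ[0⋯b]≡∑< : ∀ b f → Σ[ 0 ⋯ b ] f ≡ ∑< (suc b) f
Σ[0⋯b]≡∑< zero    f = refl
Σ[0⋯b]≡∑< (suc b) f = cong (f (suc b) +_) (Σ[0⋯b]≡∑< b f)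

Σ[1⋯n]≡∑< : ∀ n f → Σ[ 1 ⋯ n ] f ≡ ∑< n (λ k → f (suc k))
Σ[1⋯n]≡∑< zero    f = refl
Σ[1⋯n]≡∑< (suc n) f = cong (f (suc n) +_) (Σ[1⋯n]≡∑< n f)

∑<-cong : ∀ n {f g} → (∀ k → k < n → f k ≡ g k) → ∑< n f ≡ ∑< n g
∑<-cong zero    f≡g = refl
∑<-cong (suc n) f≡g =
  cong₂ _+_ (f≡g n (ℕₚ.n<1+n n)) (∑<-cong n (λ k k<n → f≡g k (ℕₚ.m<n⇒m<1+n k<n)))

∑<-zero : ∀ n {f} → (∀ k → k < n → f k ≡ 0ℚ) → ∑< n f ≡ 0ℚ
∑<-zero n f≡0 = trans (∑<-cong n f≡0) (∑<-const-0 n)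
  where
  ∑<-const-0 : ∀ n → ∑< n (λ _ → 0ℚ) ≡ 0ℚ
  ∑<-const-0 zero    = refl
  ∑<-const-0 (suc n) = trans (ℚₚ.+-identityˡ _) (∑<-const-0 n)

∑<-distrib-+ : ∀ n f g → ∑< n (λ k → f k + g k) ≡ ∑< n f + ∑< n g
∑<-distrib-+ zero    f g = refl
∑<-distrib-+ (suc n) f g =
  trans (cong (f n + g n +_) (∑<-distrib-+ n f g)) (ℚ+.interchange (f n) (g n) (∑< n f) (∑< n g))

*-distribˡ-∑< : ∀ n c f → c * ∑< n f ≡ ∑< n (λ k → c * f k)
*-distribˡ-∑< zero    c f = ℚₚ.*-zeroʳ c
*-distribˡ-∑< (suc n) c f =
  trans (ℚₚ.*-distribˡ-+ c (f n) (∑< n f)) (cong (c * f n +_) (*-distribˡ-∑< n c f))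

*-distribʳ-∑< : ∀ n c f → ∑< n f * c ≡ ∑< n (λ k → f k * c)
*-distribʳ-∑< zero    c f = ℚₚ.*-zeroˡ c
*-distribʳ-∑< (suc n) c f =
  trans (ℚₚ.*-distribʳ-+ c (f n) (∑< n f)) (cong (f n * c +_) (*-distribʳ-∑< n c f))

⊘-distribʳ-∑< : ∀ n f {y} → y ≢ 0ℚ → ∑< n f ⊘ y ≡ ∑< n (λ k → f k ⊘ y)
⊘-distribʳ-∑< n f {y} y≢0 = begin
  ∑< n f ⊘ y              ≡⟨ ⊘≡*1/ (∑< n f) y≢0 ⟩
  ∑< n f * 1/y            ≡⟨ *-distribʳ-∑< n 1/y f ⟩
  ∑< n (λ k → f k * 1/y)  ≡⟨ ∑<-cong n (λ k _ → sym (⊘≡*1/ (f k) y≢0)) ⟩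
  ∑< n (λ k → f k ⊘ y)    ∎
  where 1/y = (1/ y) {{≢-nonZero y≢0}}

Σ-horner : ∀ (f : ℕ → ℚ) x p n →
  Σ[ 1 ⋯ suc n ] (λ k → f k * x ^ (p ℕ.* (suc n ∸ k)))
    ≡ f (suc n) + x ^ p * Σ[ 1 ⋯ n ] (λ k → f k * x ^ (p ℕ.* (n ∸ k)))
Σ-horner f x p n = begin
  Σ[ 1 ⋯ suc n ] (λ k → f k * x ^ (p ℕ.* (suc n ∸ k)))
    ≡⟨ Σ[1⋯n]≡∑< (suc n) (λ k → f k * x ^ (p ℕ.* (suc n ∸ k))) ⟩
  f (suc n) * x ^ (p ℕ.* (n ∸ n)) + ∑< n (λ k → f (suc k) * x ^ (p ℕ.* (n ∸ k)))
    ≡⟨ cong₂ _+_ top (∑<-cong n shift) ⟩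
  f (suc n) + ∑< n (λ k → x ^ p * g k)
    ≡⟨ cong (f (suc n) +_) (*-distribˡ-∑< n (x ^ p) g) ⟨
  f (suc n) + x ^ p * ∑< n g
    ≡⟨ cong (λ X → f (suc n) + x ^ p * X) (Σ[1⋯n]≡∑< n (λ k → f k * x ^ (p ℕ.* (n ∸ k)))) ⟨
  f (suc n) + x ^ p * Σ[ 1 ⋯ n ] (λ k → f k * x ^ (p ℕ.* (n ∸ k)))
    ∎
  where
  g : ℕ → ℚ
  g k = f (suc k) * x ^ (p ℕ.* (n ∸ suc k))
  top : f (suc n) * x ^ (p ℕ.* (n ∸ n)) ≡ f (suc n)
  top = begin
    f (suc n) * x ^ (p ℕ.* (n ∸ n))  ≡⟨ cong (λ k → f (suc n) * x ^ (p ℕ.* k)) (ℕₚ.n∸n≡0 n) ⟩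
    f (suc n) * x ^ (p ℕ.* 0)        ≡⟨ cong (λ k → f (suc n) * x ^ k) (ℕₚ.*-zeroʳ p) ⟩
    f (suc n) * 1ℚ                   ≡⟨ ℚₚ.*-identityʳ (f (suc n)) ⟩
    f (suc n)                        ∎
  shift : ∀ k → k < n → f (suc k) * x ^ (p ℕ.* (n ∸ k)) ≡ x ^ p * g k
  shift k k<n = begin
    f (suc k) * x ^ (p ℕ.* (n ∸ k))
      ≡⟨ cong (λ j → f (suc k) * x ^ (p ℕ.* j)) (ℕₚ.+-∸-assoc 1 k<n) ⟩
    f (suc k) * x ^ (p ℕ.* suc (n ∸ suc k))
      ≡⟨ cong (λ j → f (suc k) * x ^ j) (ℕₚ.*-suc p (n ∸ suc k)) ⟩
    f (suc k) * x ^ (p ℕ.+ p ℕ.* (n ∸ suc k))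
      ≡⟨ cong (f (suc k) *_) (^-distribˡ-+-* x p (p ℕ.* (n ∸ suc k))) ⟩
    f (suc k) * (x ^ p * x ^ (p ℕ.* (n ∸ suc k)))
      ≡⟨ ℚ*.x∙yz≈y∙xz (f (suc k)) (x ^ p) _ ⟩
    x ^ p * g k
      ∎

-- The polynomial identity

σ : ℕ → ℚ
σ m = ι (signℤ m)

σ-suc : ∀ m → σ (suc m) ≡ - σ m
σ-suc m = ι-homo‿- (signℤ m)

σ-odd : ∀ h → σ (suc (h ℕ.+ h)) ≡ - 1ℚ
σ-odd zero    = refl
σ-odd (suc h) = begin
  σ (suc (suc (h ℕ.+ suc h)))    ≡⟨ cong (λ k → σ (suc (suc k))) (ℕₚ.+-suc h h) ⟩
  σ (suc (suc (suc (h ℕ.+ h))))  ≡⟨ σ-suc (suc (suc (h ℕ.+ h))) ⟩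
  - σ (suc (suc (h ℕ.+ h)))      ≡⟨ cong -_ (σ-suc (suc (h ℕ.+ h))) ⟩
  - - σ (suc (h ℕ.+ h))          ≡⟨ cong (λ z → - - z) (σ-odd h) ⟩
  - 1ℚ                           ∎

σ-2+h+h : ∀ h → σ (suc (suc (h ℕ.+ h))) ≡ 1ℚ
σ-2+h+h h = trans (σ-suc (suc (h ℕ.+ h))) (cong -_ (σ-odd h))

-- The coefficient of x^r in (1 - x²)(1 - x)^M.
coef : ℕ → ℕ → ℚ
coef M r = ι (signℤ r ℤ.* (ℤ.+ (M C r) ℤ.- ℤ.+ binomMinus2 M r))

binomMinus2-pascal : ∀ M r →
  binomMinus2 (suc M) (suc r) ≡ binomMinus2 M r ℕ.+ binomMinus2 M (suc r)
binomMinus2-pascal M zero          = refl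
binomMinus2-pascal M (suc zero)    = refl
binomMinus2-pascal M (suc (suc r)) = sym (nCk+nC[k+1]≡[n+1]C[k+1] M r)

coef-pascal : ∀ M r → coef (suc M) (suc r) ≡ coef M (suc r) - coef M r
coef-pascal M r = begin
  coef (suc M) (suc r)
    ≡⟨ cong₂ (λ a b → ι (ℤ.- s ℤ.* (ℤ.+ a ℤ.- ℤ.+ b)))
             (sym (nCk+nC[k+1]≡[n+1]C[k+1] M r)) (binomMinus2-pascal M r) ⟩
  ι (ℤ.- s ℤ.* ((c ℤ.+ c′) ℤ.- (b ℤ.+ b′)))
    ≡⟨ cong ι (regroup s c c′ b b′) ⟩
  ι (ℤ.- s ℤ.* (c′ ℤ.- b′) ℤ.- s ℤ.* (c ℤ.- b))
    ≡⟨ ι-homo-− (ℤ.- s ℤ.* (c′ ℤ.- b′)) (s ℤ.* (c ℤ.- b)) ⟩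
  coef M (suc r) - coef M r
    ∎
  where
  s = signℤ r
  c = ℤ.+ (M C r)
  c′ = ℤ.+ (M C suc r)
  b = ℤ.+ binomMinus2 M r
  b′ = ℤ.+ binomMinus2 M (suc r)
  regroup : ∀ s c c′ b b′ →
    ℤ.- s ℤ.* ((c ℤ.+ c′) ℤ.- (b ℤ.+ b′)) ≡ ℤ.- s ℤ.* (c′ ℤ.- b′) ℤ.- s ℤ.* (c ℤ.- b)
  regroup = ℤ-Solver.solve-∀

coef-middle : ∀ h → coef (h ℕ.+ h) (suc h) ≡ 0ℚ
coef-middle zero    = refl
coef-middle (suc h) = cong ι (begin
  s ℤ.* (ℤ.+ (n C suc (suc h)) ℤ.- ℤ.+ (n C h))
    ≡⟨ cong (λ c → s ℤ.* (ℤ.+ c ℤ.- ℤ.+ (n C h))) nC[h+2]≡nCh ⟩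
  s ℤ.* (ℤ.+ (n C h) ℤ.- ℤ.+ (n C h))
    ≡⟨ cong (s ℤ.*_) (ℤₚ.+-inverseʳ (ℤ.+ (n C h))) ⟩
  s ℤ.* ℤ.0ℤ
    ≡⟨ ℤₚ.*-zeroʳ s ⟩
  ℤ.0ℤ
    ∎)
  where
  n = suc h ℕ.+ suc h
  s = signℤ (suc (suc h))
  nC[h+2]≡nCh : n C suc (suc h) ≡ n C h
  nC[h+2]≡nCh =
    trans (nCk≡nC[n∸k] (ℕ.s≤s (ℕₚ.m≤n+m (suc h) h))) (cong (n C_) (ℕₚ.m+n∸n≡m h (suc h)))

pairTerm : ℕ → ℚ → ℕ → ℚ
pairTerm M x r = coef M r * (x ^ r + σ (suc M) * x ^ (suc (suc M) ∸ r))

pairSum : ℕ → ℚ → ℕ → ℚ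
pairSum M x H = ∑< (suc H) (pairTerm M x)

pairDefect : ℕ → ℚ → ℕ → ℚ
pairDefect M x H = coef M H * (x ^ suc H - σ (suc M) * x ^ (suc (suc M) ∸ H))

pairSum-suc : ∀ M x H → H ≤ suc M →
              pairSum (suc M) x H ≡ (1ℚ - x) * pairSum M x H + pairDefect M x H
pairSum-suc M x zero _ = begin
  1ℚ * (1ℚ + σ (suc (suc M)) * (x * p)) + 0ℚ
    ≡⟨ cong (λ s′ → 1ℚ * (1ℚ + s′ * (x * p)) + 0ℚ) (σ-suc (suc M)) ⟩
  1ℚ * (1ℚ + - s * (x * p)) + 0ℚ
    ≡⟨ identity s x p ⟩
  (1ℚ - x) * (1ℚ * (1ℚ + s * p) + 0ℚ) + 1ℚ * (x * 1ℚ - s * p)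
    ∎
  where
  s = σ (suc M)
  p = x ^ suc (suc M)
  identity : ∀ s x p →
    1ℚ * (1ℚ + - s * (x * p)) + 0ℚ ≡ (1ℚ - x) * (1ℚ * (1ℚ + s * p) + 0ℚ) + 1ℚ * (x * 1ℚ - s * p)
  identity = solve 3 (λ s x p →
    con 1ℚ :* (con 1ℚ :+ :- s :* (x :* p)) :+ con 0ℚ
      := (con 1ℚ :- x) :* (con 1ℚ :* (con 1ℚ :+ s :* p) :+ con 0ℚ) :+ con 1ℚ :* (x :* con 1ℚ :- s :* p)) refl
pairSum-suc M x (suc H) (ℕ.s≤s H≤M) = begin
  T + pairSum (suc M) x H
    ≡⟨ cong (T +_) (pairSum-suc M x H H≤1+M) ⟩
  T + ((1ℚ - x) * P + c * (a - s * x ^ E))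
    ≡⟨ cong (_+ ((1ℚ - x) * P + c * (a - s * x ^ E))) T≡ ⟩
  (c′ - c) * (a + - s * x ^ E) + ((1ℚ - x) * P + c * (a - s * x ^ E))
    ≡⟨ cong (λ z → (c′ - c) * (a + - s * z) + ((1ℚ - x) * P + c * (a - s * z))) xᴱ≡x*y ⟩
  (c′ - c) * (a + - s * (x * y)) + ((1ℚ - x) * P + c * (a - s * (x * y)))
    ≡⟨ identity c′ c s a x y P ⟩
  (1ℚ - x) * (c′ * (a + s * y) + P) + c′ * (x * a - s * y)
    ∎
  where
  H≤1+M = ℕₚ.m≤n⇒m≤1+n H≤M
  E = suc (suc M) ∸ H
  T = pairTerm (suc M) x (suc H)
  P = pairSum M x H
  s = σ (suc M)
  c = coef M H
  c′ = coef M (suc H)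
  a = x ^ suc H
  y = x ^ (suc M ∸ H)
  T≡ : T ≡ (c′ - c) * (a + - s * x ^ E)
  T≡ = cong₂ (λ c″ s′ → c″ * (a + s′ * x ^ E)) (coef-pascal M H) (σ-suc (suc M))
  xᴱ≡x*y : x ^ E ≡ x * y
  xᴱ≡x*y = cong (x ^_) (ℕₚ.+-∸-assoc 1 H≤1+M)
  identity : ∀ c′ c s a x y P →
    (c′ - c) * (a + - s * (x * y)) + ((1ℚ - x) * P + c * (a - s * (x * y)))
      ≡ (1ℚ - x) * (c′ * (a + s * y) + P) + c′ * (x * a - s * y)
  identity = solve 7 (λ c′ c s a x y P →
    (c′ :- c) :* (a :+ :- s :* (x :* y)) :+ ((con 1ℚ :- x) :* P :+ c :* (a :- s :* (x :* y)))
      := (con 1ℚ :- x) :* (c′ :* (a :+ s :* y) :+ P) :+ c′ :* (x :* a :- s :* y)) refl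

pairDefect-even≡0 : ∀ x h → pairDefect (suc (h ℕ.+ h)) x (suc h) ≡ 0ℚ
pairDefect-even≡0 x h = begin
  c * (a - σ (suc (suc (h ℕ.+ h))) * x ^ (suc (suc (h ℕ.+ h)) ∸ h))
    ≡⟨ cong₂ (λ s e → c * (a - s * x ^ e)) (σ-2+h+h h) (ℕₚ.m+n∸n≡m (suc (suc h)) h) ⟩
  c * (a - 1ℚ * a)
    ≡⟨ identity c a ⟩
  0ℚ
    ∎
  where
  c = coef (suc (h ℕ.+ h)) (suc h)
  a = x ^ suc (suc h)
  identity : ∀ c a → c * (a - 1ℚ * a) ≡ 0ℚ
  identity = solve 2 (λ c a → c :* (a :- con 1ℚ :* a) := con 0ℚ) refl

pairTerm+pairDefect-odd≡0 : ∀ x h →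
  pairTerm (suc (h ℕ.+ h)) x (suc h) + pairDefect (h ℕ.+ h) x h ≡ 0ℚ
pairTerm+pairDefect-odd≡0 x h = begin
  coef (suc M) (suc h) * (a + σ (suc (suc M)) * x ^ E) + c * (a - σ (suc M) * x ^ E)
    ≡⟨ cong (λ e → coef (suc M) (suc h) * (a + σ (suc (suc M)) * x ^ e) + c * (a - σ (suc M) * x ^ e))
            (ℕₚ.m+n∸n≡m (suc (suc h)) h) ⟩
  coef (suc M) (suc h) * (a + σ (suc (suc M)) * b) + c * (a - σ (suc M) * b)
    ≡⟨ cong₂ (λ c′ s → c′ * (a + s * b) + c * (a - σ (suc M) * b))
             (trans (coef-pascal M h) (cong (_- c) (coef-middle h))) (σ-2+h+h h) ⟩
  (0ℚ - c) * (a + 1ℚ * b) + c * (a - σ (suc M) * b)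
    ≡⟨ cong (λ s → (0ℚ - c) * (a + 1ℚ * b) + c * (a - s * b)) (σ-odd h) ⟩
  (0ℚ - c) * (a + 1ℚ * b) + c * (a - - 1ℚ * b)
    ≡⟨ identity c a b ⟩
  0ℚ
    ∎
  where
  M = h ℕ.+ h
  E = suc (suc M) ∸ h
  c = coef M h
  a = x ^ suc h
  b = x ^ suc (suc h)
  identity : ∀ c a b → (0ℚ - c) * (a + 1ℚ * b) + c * (a - - 1ℚ * b) ≡ 0ℚ
  identity = solve 3 (λ c a b →
    (con 0ℚ :- c) :* (a :+ con 1ℚ :* b) :+ c :* (a :- :- con 1ℚ :* b) := con 0ℚ) refl

[1-x]*AB+0≡A*[1-x]B : ∀ x A B → (1ℚ - x) * (A * B) + 0ℚ ≡ A * ((1ℚ - x) * B)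
[1-x]*AB+0≡A*[1-x]B = solve 3 (λ x A B →
  (con 1ℚ :- x) :* (A :* B) :+ con 0ℚ := A :* ((con 1ℚ :- x) :* B)) refl

pairSum-even : ∀ x h → pairSum (h ℕ.+ h) x h ≡ (1ℚ - x ^ 2) * (1ℚ - x) ^ (h ℕ.+ h)
pairSum-odd  : ∀ x h → pairSum (suc (h ℕ.+ h)) x (suc h) ≡ (1ℚ - x ^ 2) * (1ℚ - x) ^ suc (h ℕ.+ h)

pairSum-even x zero    = identity x
  where
  identity : ∀ x → 1ℚ * (1ℚ + - 1ℚ * (x * (x * 1ℚ))) + 0ℚ ≡ (1ℚ - x * (x * 1ℚ)) * 1ℚ
  identity = solve 1 (λ x →
    con 1ℚ :* (con 1ℚ :+ :- con 1ℚ :* (x :* (x :* con 1ℚ))) :+ con 0ℚ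
      := (con 1ℚ :- x :* (x :* con 1ℚ)) :* con 1ℚ) refl
pairSum-even x (suc h) rewrite ℕₚ.+-suc h h = begin
  pairSum (suc M) x (suc h)
    ≡⟨ pairSum-suc M x (suc h) (ℕₚ.m≤n⇒m≤1+n (ℕ.s≤s (ℕₚ.m≤m+n h h))) ⟩
  (1ℚ - x) * pairSum M x (suc h) + pairDefect M x (suc h)
    ≡⟨ cong₂ (λ P D → (1ℚ - x) * P + D) (pairSum-odd x h) (pairDefect-even≡0 x h) ⟩
  (1ℚ - x) * ((1ℚ - x ^ 2) * (1ℚ - x) ^ M) + 0ℚ
    ≡⟨ [1-x]*AB+0≡A*[1-x]B x (1ℚ - x ^ 2) ((1ℚ - x) ^ M) ⟩
  (1ℚ - x ^ 2) * (1ℚ - x) ^ suc M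
    ∎
  where M = suc (h ℕ.+ h)

pairSum-odd x h = begin
  T + pairSum (suc M) x h
    ≡⟨ cong (T +_) (pairSum-suc M x h (ℕₚ.m≤n⇒m≤1+n (ℕₚ.m≤m+n h h))) ⟩
  T + ((1ℚ - x) * pairSum M x h + D)
    ≡⟨ ℚ+.x∙yz≈y∙xz T ((1ℚ - x) * pairSum M x h) D ⟩
  (1ℚ - x) * pairSum M x h + (T + D)
    ≡⟨ cong₂ (λ P Z → (1ℚ - x) * P + Z) (pairSum-even x h) (pairTerm+pairDefect-odd≡0 x h) ⟩
  (1ℚ - x) * ((1ℚ - x ^ 2) * (1ℚ - x) ^ M) + 0ℚ
    ≡⟨ [1-x]*AB+0≡A*[1-x]B x (1ℚ - x ^ 2) ((1ℚ - x) ^ M) ⟩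
  (1ℚ - x ^ 2) * (1ℚ - x) ^ suc M
    ∎
  where
  M = h ℕ.+ h
  T = pairTerm (suc M) x (suc h)
  D = pairDefect M x h

even⊎odd : ∀ M → ∃[ h ] (M ≡ h ℕ.+ h ⊎ M ≡ suc (h ℕ.+ h))
even⊎odd zero    = 0 , inj₁ refl
even⊎odd (suc M) with even⊎odd M
... | h , inj₁ M≡h+h   = h , inj₂ (cong suc M≡h+h)
... | h , inj₂ M≡1+h+h = suc h , inj₁ (cong suc (trans M≡1+h+h (sym (ℕₚ.+-suc h h))))

pairSum-⌈M/2⌉ : ∀ M x → pairSum M x ⌈ M /2⌉ ≡ (1ℚ - x ^ 2) * (1ℚ - x) ^ M
pairSum-⌈M/2⌉ M x with even⊎odd M
... | h , inj₁ refl =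
  trans (cong (pairSum (h ℕ.+ h) x) (sym (ℕₚ.n≡⌈n+n/2⌉ h))) (pairSum-even x h)
... | h , inj₂ refl =
  trans (cong (λ H → pairSum (suc (h ℕ.+ h)) x (suc H)) (sym (ℕₚ.n≡⌊n+n/2⌋ h))) (pairSum-odd x h)

-- The recurrence in n

-- With a = q^((m+1)/2 - r) and w = q^r this is the numerator of the r-th summand of RHS.
numerator : ℚ → ℚ → ℚ → ℚ → ℕ → ℚ
numerator c s a w n = c * (1ℚ - a ^ n) * (1ℚ + s * a ^ suc n) * w ^ n

numerator-zero : ∀ c s a w → numerator c s a w 0 ≡ 0ℚ
numerator-zero c s a w = identity c s a
  where
  identity : ∀ c s a → c * (1ℚ - 1ℚ) * (1ℚ + s * (a * 1ℚ)) * 1ℚ ≡ 0ℚ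
  identity = solve 3 (λ c s a →
    c :* (con 1ℚ :- con 1ℚ) :* (con 1ℚ :+ s :* (a :* con 1ℚ)) :* con 1ℚ := con 0ℚ) refl

numerator-suc : ∀ c s a w n →
  numerator c s a w (suc n)
    ≡ c * (w ^ suc n + s * ((a ^ suc n) ^ 2 * w ^ suc n)) * (1ℚ - a) + a * w * numerator c s a w n
numerator-suc c s a w n = identity c s a w (a ^ n) (w ^ n)
  where
  identity : ∀ c s a w aⁿ wⁿ →
    c * (1ℚ - a * aⁿ) * (1ℚ + s * (a * (a * aⁿ))) * (w * wⁿ)
      ≡ c * (w * wⁿ + s * ((a * aⁿ) * ((a * aⁿ) * 1ℚ) * (w * wⁿ))) * (1ℚ - a)
        + a * w * (c * (1ℚ - aⁿ) * (1ℚ + s * (a * aⁿ)) * wⁿ)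
  identity = solve 6 (λ c s a w aⁿ wⁿ →
    c :* (con 1ℚ :- a :* aⁿ) :* (con 1ℚ :+ s :* (a :* (a :* aⁿ))) :* (w :* wⁿ)
      := c :* (w :* wⁿ :+ s :* ((a :* aⁿ) :* ((a :* aⁿ) :* con 1ℚ) :* (w :* wⁿ))) :* (con 1ℚ :- a)
         :+ a :* w :* (c :* (con 1ℚ :- aⁿ) :* (con 1ℚ :+ s :* (a :* aⁿ)) :* wⁿ)) refl

n/2≡⌊n/2⌋ : ∀ n → n ℕ./ 2 ≡ ⌊ n /2⌋
n/2≡⌊n/2⌋ zero          = refl
n/2≡⌊n/2⌋ (suc zero)    = refl
n/2≡⌊n/2⌋ (suc (suc n)) =
  trans (m/n≡1+[m∸n]/n {suc (suc n)} (ℕ.s≤s (ℕ.s≤s ℕ.z≤n))) (cong suc (n/2≡⌊n/2⌋ n))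

r≤⌈M/2⌉⇒2r≤1+M : ∀ {M r} → r ≤ ⌈ M /2⌉ → 2 ℕ.* r ≤ suc M
r≤⌈M/2⌉⇒2r≤1+M {M} {r} r≤⌈M/2⌉ =
  subst₂ _≤_ (cong (r ℕ.+_) (sym (ℕₚ.+-identityʳ r))) (ℕₚ.⌊n/2⌋+⌈n/2⌉≡n (suc M))
    (ℕₚ.+-mono-≤ r≤⌈M/2⌉ (ℕₚ.≤-trans r≤⌈M/2⌉ (ℕₚ.⌊n/2⌋≤⌈n/2⌉ (suc M))))

exponent : ℕ → ℕ → ℕ
exponent M r = suc M ℕ.+ 1 ∸ 2 ℕ.* r

module _ {M : ℕ} (r : ℕ) (2r≤1+M : 2 ℕ.* r ≤ suc M) where

  exponent+2r≡2+M : exponent M r ℕ.+ 2 ℕ.* r ≡ suc M ℕ.+ 1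
  exponent+2r≡2+M = ℕₚ.m∸n+n≡m (ℕₚ.m≤n⇒m≤n+o 1 2r≤1+M)

  exponent≡1+[1+M∸2r] : exponent M r ≡ suc (suc M ∸ 2 ℕ.* r)
  exponent≡1+[1+M∸2r] = trans (ℕₚ.+-∸-comm 1 2r≤1+M) (ℕₚ.+-comm _ 1)

  2+M∸r≡exponent+r : suc (suc M) ∸ r ≡ exponent M r ℕ.+ r
  2+M∸r≡exponent+r = begin
    suc (suc M) ∸ r            ≡⟨ cong (_∸ r) 2+M≡e+r+r ⟩
    e ℕ.+ r ℕ.+ r ∸ r          ≡⟨ ℕₚ.m+n∸n≡m (e ℕ.+ r) r ⟩
    e ℕ.+ r                    ∎
    where
    e = exponent M r
    2+M≡e+r+r : suc (suc M) ≡ e ℕ.+ r ℕ.+ r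
    2+M≡e+r+r = begin
      suc (suc M)              ≡⟨ ℕₚ.+-comm 1 (suc M) ⟩
      suc M ℕ.+ 1              ≡⟨ exponent+2r≡2+M ⟨
      e ℕ.+ (r ℕ.+ (r ℕ.+ 0))  ≡⟨ cong (λ k → e ℕ.+ (r ℕ.+ k)) (ℕₚ.+-identityʳ r) ⟩
      e ℕ.+ (r ℕ.+ r)          ≡⟨ ℕₚ.+-assoc e r r ⟨
      e ℕ.+ r ℕ.+ r            ∎

recurrence-unique : ∀ {A : Set} {f g : ℕ → A} (step : ℕ → A → A) → f 0 ≡ g 0 →
                    (∀ n → f (suc n) ≡ step n (f n)) → (∀ n → g (suc n) ≡ step n (g n)) →
                    ∀ n → f n ≡ g n
recurrence-unique step f0≡g0 f-suc g-suc zero    = f0≡g0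
recurrence-unique step f0≡g0 f-suc g-suc (suc n) =
  trans (f-suc n) (trans (cong (step n) (recurrence-unique step f0≡g0 f-suc g-suc n)) (sym (g-suc n)))

module _ (M : ℕ) (t : ℚ) where

  q ρ denominator : ℚ
  q = t ^ 2
  ρ = t ^ (suc M ℕ.+ 1)
  denominator = (1ℚ - q ^ 2) * (1ℚ - q) ^ M

  weight : ℕ → ℚ
  weight k = ((1ℚ - q ^ (2 ℕ.* k)) ⊘ (1ℚ - q ^ 2)) * ((1ℚ - q ^ k) ⊘ (1ℚ - q)) ^ M

  S-suc : ∀ n → S (suc M) (suc n) t ≡ weight (suc n) + ρ * S (suc M) n t
  S-suc = Σ-horner weight t (suc M ℕ.+ 1)

  R-summand : ℕ → ℕ → ℚ
  R-summand n r =
    (coef M r * (1ℚ - t ^ (e ℕ.* n)) * (1ℚ + σ (suc M) * t ^ (e ℕ.* (n ℕ.+ 1))) * q ^ (r ℕ.* n))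
    ⊘ (denominator * (1ℚ - t ^ e))
    where e = exponent M r

  RHS≡∑R-summand : ∀ n → RHS (suc M) n t ≡ ∑< (suc ⌈ M /2⌉) (R-summand n)
  RHS≡∑R-summand n =
    trans (cong (λ b → Σ[ 0 ⋯ b ] (R-summand n)) (n/2≡⌊n/2⌋ (suc M)))
          (Σ[0⋯b]≡∑< ⌈ M /2⌉ (R-summand n))

  R-summand≡numerator : ∀ n r → let a = t ^ exponent M r in
    R-summand n r ≡ numerator (coef M r) (σ (suc M)) a (q ^ r) n ⊘ (denominator * (1ℚ - a))
  R-summand≡numerator n r = cong (_⊘ (denominator * (1ℚ - t ^ e))) (begin
    c * (1ℚ - t ^ (e ℕ.* n)) * (1ℚ + s * t ^ (e ℕ.* (n ℕ.+ 1))) * q ^ (r ℕ.* n)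
      ≡⟨ cong₂ (λ u v → c * (1ℚ - u) * (1ℚ + s * v) * q ^ (r ℕ.* n)) (^-*-assoc t e n) aⁿ⁺¹≡ ⟨
    c * (1ℚ - (t ^ e) ^ n) * (1ℚ + s * (t ^ e) ^ suc n) * q ^ (r ℕ.* n)
      ≡⟨ cong (c * (1ℚ - (t ^ e) ^ n) * (1ℚ + s * (t ^ e) ^ suc n) *_) (^-*-assoc q r n) ⟨
    numerator c s (t ^ e) (q ^ r) n
      ∎)
    where
    e = exponent M r
    c = coef M r
    s = σ (suc M)
    aⁿ⁺¹≡ : (t ^ e) ^ suc n ≡ t ^ (e ℕ.* (n ℕ.+ 1))
    aⁿ⁺¹≡ = trans (^-*-assoc t e (suc n)) (cong (λ k → t ^ (e ℕ.* k)) (ℕₚ.+-comm 1 n))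

  RHS-zero : RHS (suc M) 0 t ≡ 0ℚ
  RHS-zero = trans (RHS≡∑R-summand 0) (∑<-zero (suc ⌈ M /2⌉) λ r _ → begin
    R-summand 0 r
      ≡⟨ R-summand≡numerator 0 r ⟩
    numerator (coef M r) (σ (suc M)) (a r) (q ^ r) 0 ⊘ D r
      ≡⟨ cong (_⊘ D r) (numerator-zero (coef M r) (σ (suc M)) (a r) (q ^ r)) ⟩
    0ℚ ⊘ D r
      ≡⟨ 0⊘y≡0 (D r) ⟩
    0ℚ
      ∎)
    where
    a D : ℕ → ℚ
    a r = t ^ exponent M r
    D r = denominator * (1ℚ - a r)

  module _ (r : ℕ) (2r≤1+M : 2 ℕ.* r ≤ suc M) where

    ρ≡q^[[m+1]/2-r]*qʳ : ρ ≡ t ^ exponent M r * q ^ r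
    ρ≡q^[[m+1]/2-r]*qʳ = begin
      t ^ (suc M ℕ.+ 1)                 ≡⟨ cong (t ^_) (exponent+2r≡2+M r 2r≤1+M) ⟨
      t ^ (exponent M r ℕ.+ 2 ℕ.* r)    ≡⟨ ^-distribˡ-+-* t (exponent M r) (2 ℕ.* r) ⟩
      t ^ exponent M r * t ^ (2 ℕ.* r)  ≡⟨ cong (t ^ exponent M r *_) (^-*-assoc t 2 r) ⟨
      t ^ exponent M r * q ^ r          ∎

    pairTerm-qⁿ⁺¹ : ∀ n → let a = t ^ exponent M r; w = q ^ r in
      pairTerm M (q ^ suc n) r ≡ coef M r * (w ^ suc n + σ (suc M) * ((a ^ suc n) ^ 2 * w ^ suc n))
    pairTerm-qⁿ⁺¹ n = begin
      c * (x ^ r + s * x ^ (suc (suc M) ∸ r))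
        ≡⟨ cong (λ k → c * (x ^ r + s * x ^ k)) (2+M∸r≡exponent+r r 2r≤1+M) ⟩
      c * (x ^ r + s * x ^ (e ℕ.+ r))
        ≡⟨ cong (λ y → c * (x ^ r + s * y)) (^-distribˡ-+-* x e r) ⟩
      c * (x ^ r + s * (x ^ e * x ^ r))
        ≡⟨ cong₂ (λ y z → c * (y + s * (z * y))) xʳ≡wⁿ⁺¹ xᵉ≡[aⁿ⁺¹]² ⟩
      c * (w ^ suc n + s * ((a ^ suc n) ^ 2 * w ^ suc n))
        ∎
      where
      e = exponent M r
      x = q ^ suc n
      a = t ^ e
      w = q ^ r
      c = coef M r
      s = σ (suc M)
      xʳ≡wⁿ⁺¹ : x ^ r ≡ w ^ suc n
      xʳ≡wⁿ⁺¹ = ^-comm q (suc n) r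
      xᵉ≡[aⁿ⁺¹]² : x ^ e ≡ (a ^ suc n) ^ 2
      xᵉ≡[aⁿ⁺¹]² = begin
        x ^ e            ≡⟨ ^-comm q (suc n) e ⟩
        (q ^ e) ^ suc n  ≡⟨ cong (_^ suc n) (^-comm t 2 e) ⟩
        (a ^ 2) ^ suc n  ≡⟨ ^-comm a 2 (suc n) ⟩
        (a ^ suc n) ^ 2  ∎

  module _ (t^j≢1 : ∀ j → t ^ suc j ≢ 1ℚ) where

    1-q≢0 : 1ℚ - q ≢ 0ℚ
    1-q≢0 = 1-x≢0 (t^j≢1 1)

    1-q²≢0 : 1ℚ - q ^ 2 ≢ 0ℚ
    1-q²≢0 = 1-x≢0 (subst (_≢ 1ℚ) (sym (^-*-assoc t 2 2)) (t^j≢1 3))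

    denominator≢0 : denominator ≢ 0ℚ
    denominator≢0 = *-≢0 1-q²≢0 (^-≢0 M 1-q≢0)

    weight-suc : ∀ n → let x = q ^ suc n in
      weight (suc n) ≡ ((1ℚ - x ^ 2) * (1ℚ - x) ^ M) ⊘ denominator
    weight-suc n = begin
      ((1ℚ - q ^ (2 ℕ.* suc n)) ⊘ (1ℚ - q ^ 2)) * ((1ℚ - x) ⊘ (1ℚ - q)) ^ M
        ≡⟨ cong (λ y → ((1ℚ - y) ⊘ (1ℚ - q ^ 2)) * ((1ℚ - x) ⊘ (1ℚ - q)) ^ M)
                (trans (sym (^-*-assoc q 2 (suc n))) (^-comm q 2 (suc n))) ⟩
      ((1ℚ - x ^ 2) ⊘ (1ℚ - q ^ 2)) * ((1ℚ - x) ⊘ (1ℚ - q)) ^ M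
        ≡⟨ cong (((1ℚ - x ^ 2) ⊘ (1ℚ - q ^ 2)) *_) (⊘-^ (1ℚ - x) M 1-q≢0) ⟩
      ((1ℚ - x ^ 2) ⊘ (1ℚ - q ^ 2)) * ((1ℚ - x) ^ M ⊘ (1ℚ - q) ^ M)
        ≡⟨ ⊘-*-⊘ (1ℚ - x ^ 2) ((1ℚ - x) ^ M) 1-q²≢0 (^-≢0 M 1-q≢0) ⟩
      ((1ℚ - x ^ 2) * (1ℚ - x) ^ M) ⊘ denominator
        ∎
      where x = q ^ suc n

    R-summand-suc : ∀ n r → r ≤ ⌈ M /2⌉ →
      R-summand (suc n) r ≡ pairTerm M (q ^ suc n) r ⊘ denominator + ρ * R-summand n r
    R-summand-suc n r r≤⌈M/2⌉ = begin
      R-summand (suc n) r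
        ≡⟨ R-summand≡numerator (suc n) r ⟩
      N (suc n) ⊘ (denominator * (1ℚ - a))
        ≡⟨ cong (_⊘ (denominator * (1ℚ - a))) (numerator-suc c s a w n) ⟩
      (P * (1ℚ - a) + a * w * N n) ⊘ (denominator * (1ℚ - a))
        ≡⟨ ⊘-split P (a * w) (N n) denominator≢0 1-a≢0 ⟩
      P ⊘ denominator + a * w * (N n ⊘ (denominator * (1ℚ - a)))
        ≡⟨ cong (λ R → P ⊘ denominator + a * w * R) (R-summand≡numerator n r) ⟨
      P ⊘ denominator + a * w * R-summand n r
        ≡⟨ cong₂ (λ P′ ρ′ → P′ ⊘ denominator + ρ′ * R-summand n r)
                 (pairTerm-qⁿ⁺¹ r 2r≤1+M n) (ρ≡q^[[m+1]/2-r]*qʳ r 2r≤1+M) ⟨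
      pairTerm M (q ^ suc n) r ⊘ denominator + ρ * R-summand n r
        ∎
      where
      2r≤1+M = r≤⌈M/2⌉⇒2r≤1+M r≤⌈M/2⌉
      a = t ^ exponent M r
      w = q ^ r
      c = coef M r
      s = σ (suc M)
      N = numerator c s a w
      P = c * (w ^ suc n + s * ((a ^ suc n) ^ 2 * w ^ suc n))
      1-a≢0 : 1ℚ - a ≢ 0ℚ
      1-a≢0 = 1-x≢0 (subst (λ k → t ^ k ≢ 1ℚ) (sym (exponent≡1+[1+M∸2r] r 2r≤1+M))
                            (t^j≢1 (suc M ∸ 2 ℕ.* r)))

    RHS-suc : ∀ n → RHS (suc M) (suc n) t ≡ weight (suc n) + ρ * RHS (suc M) n t
    RHS-suc n = begin
      RHS (suc M) (suc n) t
        ≡⟨ RHS≡∑R-summand (suc n) ⟩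
      ∑< H (R-summand (suc n))
        ≡⟨ ∑<-cong H (λ r r<H → R-summand-suc n r (ℕₚ.≤-pred r<H)) ⟩
      ∑< H (λ r → pairTerm M x r ⊘ denominator + ρ * R-summand n r)
        ≡⟨ ∑<-distrib-+ H (λ r → pairTerm M x r ⊘ denominator) (λ r → ρ * R-summand n r) ⟩
      ∑< H (λ r → pairTerm M x r ⊘ denominator) + ∑< H (λ r → ρ * R-summand n r)
        ≡⟨ cong₂ _+_ (⊘-distribʳ-∑< H (pairTerm M x) denominator≢0) (*-distribˡ-∑< H ρ (R-summand n)) ⟨
      pairSum M x ⌈ M /2⌉ ⊘ denominator + ρ * ∑< H (R-summand n)
        ≡⟨ cong₂ (λ P R → P ⊘ denominator + ρ * R) (pairSum-⌈M/2⌉ M x) (sym (RHS≡∑R-summand n)) ⟩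
      ((1ℚ - x ^ 2) * (1ℚ - x) ^ M) ⊘ denominator + ρ * RHS (suc M) n t
        ≡⟨ cong (_+ ρ * RHS (suc M) n t) (weight-suc n) ⟨
      weight (suc n) + ρ * RHS (suc M) n t
        ∎
      where
      H = suc ⌈ M /2⌉
      x = q ^ suc n

-- Both sides vanish at n = 0.
lemma2p1 : (m n : ℕ) → 1 ≤ m → 1 ≤ n →
    (t : ℚ) → (∀ (j : ℕ) → t ^ suc j ≢ 1ℚ) →
    S m n t ≡ RHS m n t
lemma2p1 zero    _ () _ _ _
lemma2p1 (suc M) n _  _ t t^j≢1 =
  recurrence-unique {f = λ n → S (suc M) n t} {g = λ n → RHS (suc M) n t}
    (λ n X → weight M t (suc n) + ρ M t * X) (sym (RHS-zero M t)) (S-suc M t) (RHS-suc M t t^j≢1) n
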